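{- A finite simplicial complex $\Delta$ is shifted with respect to $\{v_1<\cdots<v_t\}$ if and only if it is a $t$-fold near-cone with respect to $\{v_1<\cdots<v_t\}$.
   Context: A simplicial complex is a finite nonempty family of sets closed under taking subsets. $\Delta$ is shifted with respect to $\{v_1<\cdots<v_t\}$ if for every $i$, every vertex $w\notin\{v_1,\dots,v_i\}$ and every face $B$ with $w\in B$, $v_i\notin B$, also $(B\setminus\{w\})\cup\{v_i\}\in\Delta$. $\Delta$ is a near-cone with apex vertex $a$ if whenever $B\in\Delta$ and $w\in B$, also $(B\setminus\{w\})\cup\{a\}\in\Delta$. The deletion is $\operatorname{del}_\Delta v=\{B\in\Delta: v\notin B\}$ and the link is $\operatorname{link}_\Delta v=\{B\in\Delta: v\notin B,\ B\cup\{v\}\in\Delta\}$. Recursively, $\Delta$ is a $t$-fold near-cone with respect to $\{v_1<\cdots<v_t\}$ if either $t=0$, or $\Delta$ is a near-cone with apex vertex $v_1$ such that both $\operatorname{del}_\Delta v_1$ and $\operatorname{link}_\Delta v_1$ are $(t-1)$-fold near-cones with respect to $\{v_2<\cdots<v_t\}$. -}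

module Defs where

open import Data.Nat using (ℕ)
open import Data.Fin using (Fin)
open import Data.Fin.Subset using (Subset; _∈_; _∉_; _⊆_; _∪_; _-_; ⁅_⁆)
open import Data.List using (List; []; _∷_; _++_)
import Data.List.Membership.Propositional as LM
open import Data.Product using (∃; _×_)
open import Relation.Binary.PropositionalEquality using (_≡_)
open import Relation.Nullary using (¬_)
open import Data.Unit using (⊤)

-- A family of faces on the finite vertex set Fin n, given as a predicate
-- on subsets of Fin n (so every such family is automatically finite).
Family : ℕ → Set₁
Family n = Subset n → Set

record IsSimplicialComplex {n : ℕ} (Δ : Family n) : Set where
  field
    nonempty : ∃ λ B → Δ B
    down-closed : ∀ {A B} → A ⊆ B → Δ B → Δ A

-- Shifted with respect to the ordered list vs = [v₁, …, v_t]: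
-- for every split vs = pre ++ vᵢ ∷ post (so pre ++ [vᵢ] = {v₁,…,vᵢ}),
-- every vertex w ∉ {v₁,…,vᵢ} and every face B with w ∈ B, vᵢ ∉ B,
-- the set (B ∖ {w}) ∪ {vᵢ} is a face.
Shifted : {n : ℕ} → Family n → List (Fin n) → Set
Shifted {n} Δ vs =
  ∀ (pre : List (Fin n)) (v : Fin n) (post : List (Fin n)) →
  vs ≡ pre ++ (v ∷ post) →
  ∀ (w : Fin n) (B : Subset n) →
  ¬ (w LM.∈ (v ∷ pre)) →
  Δ B → w ∈ B → v ∉ B → Δ ((B - w) ∪ ⁅ v ⁆)

NearCone : {n : ℕ} → Family n → Fin n → Set
NearCone {n} Δ a = ∀ (B : Subset n) (w : Fin n) → Δ B → w ∈ B → Δ ((B - w) ∪ ⁅ a ⁆)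

del : {n : ℕ} → Family n → Fin n → Family n
del Δ v B = Δ B × v ∉ B

link : {n : ℕ} → Family n → Fin n → Family n
link Δ v B = v ∉ B × Δ (B ∪ ⁅ v ⁆)

FoldNearCone : {n : ℕ} → List (Fin n) → Family n → Set
FoldNearCone []       Δ = ⊤
FoldNearCone (v ∷ vs) Δ =
  NearCone Δ v × FoldNearCone vs (del Δ v) × FoldNearCone vs (link Δ v)

-- Peeling off the first vertex v₁: a split of v₁ ∷ vs either has v₁ in the middle, where the
-- shifting condition is exactly the near-cone condition at v₁, or lies inside vs.  A shift
-- inside vs applied to a face B is a shift in the deletion when v₁ ∉ B, and a shift in the link
-- (after removing v₁ from B) when v₁ ∈ B; conversely shifts in the deletion and the link are
-- shifts of faces of Δ.  Both directions only use that Δ is closed under subsets, a property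
-- inherited by deletions and links, so the argument is an induction on the list of vertices.
module Submission where

open import Defs
open import Data.Nat using (ℕ)
open import Data.Fin using (Fin; _≟_)
open import Data.Fin.Subset using (Subset; _∈_; _∉_; _⊆_; _∪_; _-_; _─_; ⁅_⁆; inside; outside)
open import Data.Fin.Subset.Properties
  using (x∈p∪q⁻; x∈p∪q⁺; x∈⁅x⁆; x∈⁅y⁆⇒x≡y; x∈p∧x≢y⇒x∈p-y; p─q⊆p; p⊆p∪q; _∈?_)
open import Data.Vec.Base using (_∷_; here; there)
open import Data.List using (List; []; _∷_; _++_)
import Data.List.Membership.Propositional as List
open import Data.List.Relation.Unary.Any using (here; there)
open import Data.List.Relation.Unary.All using (All; head)
open import Data.List.Relation.Unary.All.Properties using (++⁻ʳ)
open import Data.List.Relation.Unary.AllPairs using (_∷_)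
open import Data.List.Relation.Unary.Unique.Propositional using (Unique)
open import Data.Product using (_,_; proj₁; proj₂)
open import Data.Sum using (_⊎_; inj₁; inj₂)
open import Data.Unit using (tt)
open import Function using (_∘_)
open import Function.Bundles using (_⇔_; mk⇔; Equivalence)
open import Relation.Binary.PropositionalEquality using (_≡_; _≢_; refl; sym)
open import Relation.Nullary using (¬_; yes; no)

x∈p─q⇒x∉q : ∀ {n} {x : Fin n} (p q : Subset n) → x ∈ p ─ q → x ∉ q
x∈p─q⇒x∉q (inside ∷ p) (outside ∷ q) here       ()
x∈p─q⇒x∉q (_ ∷ p)      (_ ∷ q)       (there x∈) (there x∈q) = x∈p─q⇒x∉q p q x∈ x∈q

module _ {n : ℕ} where

  x∈p-y⇒x≢y : ∀ {x y : Fin n} (p : Subset n) → x ∈ p - y → x ≢ y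
  x∈p-y⇒x≢y {y = y} p x∈ refl = x∈p─q⇒x∉q p ⁅ y ⁆ x∈ (x∈⁅x⁆ y)

  x∈p∪⁅y⁆⁻ : ∀ {x : Fin n} (p : Subset n) y → x ∈ p ∪ ⁅ y ⁆ → x ∈ p ⊎ x ≡ y
  x∈p∪⁅y⁆⁻ p y x∈ with x∈p∪q⁻ p ⁅ y ⁆ x∈
  ... | inj₁ x∈p = inj₁ x∈p
  ... | inj₂ x∈y = inj₂ (x∈⁅y⁆⇒x≡y y x∈y)

  x∈p∪⁅x⁆ : ∀ {x : Fin n} {p : Subset n} → x ∈ p ∪ ⁅ x ⁆
  x∈p∪⁅x⁆ {x} = x∈p∪q⁺ (inj₂ (x∈⁅x⁆ x))

  x∉p∪⁅y⁆ : ∀ {x y : Fin n} {p : Subset n} → x ∉ p → x ≢ y → x ∉ p ∪ ⁅ y ⁆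
  x∉p∪⁅y⁆ {y = y} {p} x∉p x≢y x∈ with x∈p∪⁅y⁆⁻ p y x∈
  ... | inj₁ x∈p = x∉p x∈p
  ... | inj₂ x≡y = x≢y x≡y

  p∪⁅x⁆⊆q : ∀ {x : Fin n} {p q : Subset n} → p ⊆ q → x ∈ q → p ∪ ⁅ x ⁆ ⊆ q
  p∪⁅x⁆⊆q {x} {p} p⊆q x∈q y∈ with x∈p∪⁅y⁆⁻ p x y∈
  ... | inj₁ y∈p = p⊆q y∈p
  ... | inj₂ refl = x∈q

  p⊆p-x∪⁅x⁆ : ∀ (p : Subset n) x → p ⊆ (p - x) ∪ ⁅ x ⁆
  p⊆p-x∪⁅x⁆ p x {y} y∈p with y ≟ x
  ... | yes refl = x∈p∪⁅x⁆
  ... | no y≢x   = p⊆p∪q _ (x∈p∧x≢y⇒x∈p-y y∈p y≢x)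

  shift : Subset n → Fin n → Fin n → Subset n
  shift B w v = (B - w) ∪ ⁅ v ⁆

  shift-mono : ∀ {p q : Subset n} {w v} → p ⊆ q → shift p w v ⊆ shift q w v
  shift-mono {p} p⊆q =
    p∪⁅x⁆⊆q (λ x∈ → p⊆p∪q _ (x∈p∧x≢y⇒x∈p-y (p⊆q (p─q⊆p p _ x∈)) (x∈p-y⇒x≢y p x∈)))
            x∈p∪⁅x⁆

  shift-⊆ : ∀ {p : Subset n} {w v} → v ∈ p → shift p w v ⊆ p
  shift-⊆ {p} = p∪⁅x⁆⊆q (p─q⊆p p _)

  shift-∪⁅⁆⊆ : ∀ (p : Subset n) u w v → shift (p ∪ ⁅ u ⁆) w v ⊆ shift p w v ∪ ⁅ u ⁆
  shift-∪⁅⁆⊆ p u w v = p∪⁅x⁆⊆q removed (p⊆p∪q _ x∈p∪⁅x⁆)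
    where
    removed : (p ∪ ⁅ u ⁆) - w ⊆ shift p w v ∪ ⁅ u ⁆
    removed {x} x∈ with x∈p∪⁅y⁆⁻ p u (p─q⊆p _ _ x∈)
    ... | inj₁ x∈p = p⊆p∪q _ (p⊆p∪q _ (x∈p∧x≢y⇒x∈p-y x∈p (x∈p-y⇒x≢y _ x∈)))
    ... | inj₂ refl = x∈p∪⁅x⁆

  ∪⁅⁆-shift⊆ : ∀ (p : Subset n) {u w} v → u ≢ w → shift p w v ∪ ⁅ u ⁆ ⊆ shift (p ∪ ⁅ u ⁆) w v
  ∪⁅⁆-shift⊆ p v u≢w =
    p∪⁅x⁆⊆q (shift-mono (p⊆p∪q _)) (p⊆p∪q _ (x∈p∧x≢y⇒x∈p-y x∈p∪⁅x⁆ u≢w))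

  ∉-∷-skip : ∀ {w x y : Fin n} {ys} → ¬ (w List.∈ x ∷ ys) → w ≢ y → ¬ (w List.∈ x ∷ y ∷ ys)
  ∉-∷-skip w∉ w≢y (here w≡x)           = w∉ (here w≡x)
  ∉-∷-skip w∉ w≢y (there (here w≡y))   = w≢y w≡y
  ∉-∷-skip w∉ w≢y (there (there w∈ys)) = w∉ (there w∈ys)

  ∈-∷-skip : ∀ {w x y : Fin n} {ys} → w List.∈ x ∷ ys → w List.∈ x ∷ y ∷ ys
  ∈-∷-skip (here w≡x)   = here w≡x
  ∈-∷-skip (there w∈ys) = there (there w∈ys)

DownClosed : {n : ℕ} → Family n → Set
DownClosed Δ = ∀ {A B} → A ⊆ B → Δ B → Δ A

module _ {n : ℕ} {Δ : Family n} (closed : DownClosed Δ) where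

  del-downClosed : ∀ v → DownClosed (del Δ v)
  del-downClosed v A⊆B (ΔB , v∉B) = closed A⊆B ΔB , v∉B ∘ A⊆B

  link-downClosed : ∀ v → DownClosed (link Δ v)
  link-downClosed v A⊆B (v∉B , ΔB∪v) =
    v∉B ∘ A⊆B , closed (p∪⁅x⁆⊆q (λ x∈A → p⊆p∪q _ (A⊆B x∈A)) x∈p∪⁅x⁆) ΔB∪v

  shifted⇒nearCone : ∀ {v vs} → Shifted Δ (v ∷ vs) → NearCone Δ v
  shifted⇒nearCone {v} {vs} sh B w ΔB w∈B with v ∈? B
  ... | yes v∈B = closed (shift-⊆ v∈B) ΔB
  ... | no v∉B  = sh [] v vs refl w B (λ { (here refl) → v∉B w∈B }) ΔB w∈B v∉B

  shifted⇒shifted-del : ∀ {v vs} → All (v ≢_) vs → Shifted Δ (v ∷ vs) → Shifted (del Δ v) vs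
  shifted⇒shifted-del {v} v∉vs sh pre u post refl w B w∉ (ΔB , v∉B) w∈B u∉B =
    sh (v ∷ pre) u post refl w B (∉-∷-skip w∉ (λ { refl → v∉B w∈B })) ΔB w∈B u∉B ,
    x∉p∪⁅y⁆ (v∉B ∘ p─q⊆p B _) (head (++⁻ʳ pre v∉vs))

  shifted⇒shifted-link : ∀ {v vs} → All (v ≢_) vs → Shifted Δ (v ∷ vs) → Shifted (link Δ v) vs
  shifted⇒shifted-link {v} v∉vs sh pre u post refl w B w∉ (v∉B , ΔB∪v) w∈B u∉B =
    x∉p∪⁅y⁆ (v∉B ∘ p─q⊆p B _) v≢u ,
    closed (∪⁅⁆-shift⊆ B u v≢w)
      (sh (v ∷ pre) u post refl w (B ∪ ⁅ v ⁆) (∉-∷-skip w∉ (v≢w ∘ sym))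
          ΔB∪v (p⊆p∪q _ w∈B) (x∉p∪⁅y⁆ u∉B (v≢u ∘ sym)))
    where
    v≢u : v ≢ u
    v≢u = head (++⁻ʳ pre v∉vs)
    v≢w : v ≢ w
    v≢w refl = v∉B w∈B

  nearCone×shifted-del×shifted-link⇒shifted : ∀ {v vs} → NearCone Δ v →
    Shifted (del Δ v) vs → Shifted (link Δ v) vs → Shifted Δ (v ∷ vs)
  nearCone×shifted-del×shifted-link⇒shifted nc shd shl [] v post refl w B w∉ ΔB w∈B v∉B =
    nc B w ΔB w∈B
  nearCone×shifted-del×shifted-link⇒shifted {v₁} nc shd shl (_ ∷ pre) v post refl w B w∉ ΔB w∈B v∉B
    with v₁ ∈? B
  ... | no v₁∉B = proj₁ (shd pre v post refl w B (w∉ ∘ ∈-∷-skip) (ΔB , v₁∉B) w∈B v∉B)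
  ... | yes v₁∈B =
    closed (λ x∈ → shift-∪⁅⁆⊆ C v₁ w v (shift-mono (p⊆p-x∪⁅x⁆ B v₁) x∈))
      (proj₂ (shl pre v post refl w C (w∉ ∘ ∈-∷-skip)
                  ((λ v₁∈C → x∈p-y⇒x≢y B v₁∈C refl) , closed (shift-⊆ v₁∈B) ΔB)
                  (x∈p∧x≢y⇒x∈p-y w∈B (λ w≡v₁ → w∉ (there (here w≡v₁)))) (v∉B ∘ p─q⊆p B _)))
    where
    C : Subset n
    C = B - v₁

shifted-[] : ∀ {n} {Δ : Family n} → Shifted Δ []
shifted-[] []      _ _ ()
shifted-[] (_ ∷ _) _ _ ()

shifted⇔foldNearCone : ∀ {n} (vs : List (Fin n)) {Δ : Family n} →
  DownClosed Δ → Unique vs → Shifted Δ vs ⇔ FoldNearCone vs Δ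
shifted⇔foldNearCone []       _      _ = mk⇔ (λ _ → tt) (λ _ → shifted-[])
shifted⇔foldNearCone (v ∷ vs) closed (v∉vs ∷ unique) = mk⇔
  (λ sh → shifted⇒nearCone closed sh ,
          Equivalence.to onDel (shifted⇒shifted-del closed v∉vs sh) ,
          Equivalence.to onLink (shifted⇒shifted-link closed v∉vs sh))
  (λ (nc , fd , fl) → nearCone×shifted-del×shifted-link⇒shifted closed nc
                        (Equivalence.from onDel fd) (Equivalence.from onLink fl))
  where
  onDel  = shifted⇔foldNearCone vs (del-downClosed closed v) unique
  onLink = shifted⇔foldNearCone vs (link-downClosed closed v) unique

lemma2p15 : (n : ℕ) (Δ : Family n) → IsSimplicialComplex Δ →
    (vs : List (Fin n)) → Unique vs →
    Shifted Δ vs ⇔ FoldNearCone vs Δ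
lemma2p15 n Δ complex vs = shifted⇔foldNearCone vs (IsSimplicialComplex.down-closed complex)
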